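{- Let $t=6$, let $X\subset\mathbb{F}_2^6$ be the subspace $\{0,(1,1,1,1,1,1)\}$ and $V=\mathbb{F}_2^6/X$. Define $S:V\to\mathbb{N}$ by sending the class of $(e_1,\dots,e_6)$ to $\min\{\sum_j e_j,\ 6-\sum_j e_j\}$ (sums computed in $\mathbb{N}$, with $e_j\in\{0,1\}$), and let $V_\nu=\{u\in V: S(u)=\nu\}$. Suppose $U\subseteq V$ is an $\mathbb{F}_2$-subspace of dimension $4$ with $U\cap V_1=\varnothing$. Then there exist $a,b,c\in U\cap V_2$ with $a+b+c=0$.
   Context: The map $S$ is well defined on $V$ since adding $(1,\dots,1)$ replaces $\sum e_j$ by $6-\sum e_j$. -}

module Defs where

open import Data.Bool using (Bool; true; false; _xor_; if_then_else_)
open import Data.Nat using (ℕ; zero; suc; _⊓_; _∸_)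
open import Data.Fin using (Fin; zero; suc)
open import Data.Vec using (Vec; zipWith; replicate; count)
open import Data.Sum using (_⊎_)
open import Data.Product using (Σ; ∃; _×_)
open import Relation.Binary.PropositionalEquality using (_≡_)
open import Relation.Nullary using (¬_)
open import Data.Bool.Properties using (T?)

F₂⁶ : Set
F₂⁶ = Vec Bool 6

infixl 6 _⊕_
_⊕_ : F₂⁶ → F₂⁶ → F₂⁶
_⊕_ = zipWith _xor_

𝟘 : F₂⁶
𝟘 = replicate 6 false

-- the all-ones vector (1,1,1,1,1,1); X = {0, 𝟙}
𝟙 : F₂⁶
𝟙 = replicate 6 true

-- V = F₂⁶ / X, represented by F₂⁶ together with the congruence x ∼ y ⇔ x - y ∈ X
infix 4 _∼_
_∼_ : F₂⁶ → F₂⁶ → Set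
x ∼ y = (x ≡ y) ⊎ (x ≡ y ⊕ 𝟙)

weight : F₂⁶ → ℕ
weight = count T?

S : F₂⁶ → ℕ
S e = weight e ⊓ (6 ∸ weight e)

-- An F₂-subspace of V, given as a predicate on representatives that is
-- invariant under ∼ (i.e. a subset of V), contains 0 and is closed under +.
record IsSubspaceV (U : F₂⁶ → Set) : Set where
  field
    resp  : ∀ {x y} → x ∼ y → U x → U y
    has0  : U 𝟘
    close : ∀ {x y} → U x → U y → U (x ⊕ y)

lincomb : ∀ {n} → (Fin n → Bool) → (Fin n → F₂⁶) → F₂⁶
lincomb {zero}  c b = 𝟘
lincomb {suc n} c b =
  (if c zero then b zero else 𝟘) ⊕ lincomb (λ i → c (suc i)) (λ i → b (suc i))

record IsBasisV {n} (U : F₂⁶ → Set) (b : Fin n → F₂⁶) : Set where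
  field
    inU      : ∀ i → U (b i)
    indep    : ∀ c → lincomb c b ∼ 𝟘 → ∀ i → c i ≡ false
    spanning : ∀ x → U x → Σ (Fin n → Bool) λ c → x ∼ lincomb c b

HasDimV : (U : F₂⁶ → Set) → ℕ → Set
HasDimV U n = Σ (Fin n → F₂⁶) λ b → IsBasisV U b

-- V = F₂⁶/⟨𝟙⟩ has 2⁵ elements, fewer than the 2⁶ linear combinations of six vectors, so any six
-- vectors of V are dependent and V has dimension 5. A 4-dimensional U is therefore a hyperplane,
-- and the sum of two vectors outside U lies in U. The unit vectors e₁, e₂, e₃ have S = 1, so they
-- lie outside U, and a = e₁ + e₂, b = e₂ + e₃, c = e₁ + e₃ lie in U ∩ V₂ with a + b + c = 0.
module Submission where

open import Defs

open import Algebra.Bundles using (CommutativeMonoid)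
open import Level using (0ℓ)
open import Data.Bool using (Bool; true; false; not; _xor_; if_then_else_)
open import Data.Bool.Properties
  using (xor-assoc; xor-comm; xor-identityˡ; xor-identityʳ; xor-same; not-involutive)
  renaming (_≟_ to _≟ᴮ_)
open import Data.Empty using (⊥; ⊥-elim)
open import Data.Fin using (Fin; zero; suc; combine; quotient; remainder)
open import Data.Fin.Properties using (2↔Bool; pigeonhole; combine-injective; combine-remQuot; <-irrefl)
open import Data.Nat as ℕ using (_<_; _^_; s≤s; z≤n)
open import Data.Nat.Properties using (^-monoʳ-<; n<1+n)
open import Data.Product using (Σ; _×_; _,_; proj₂; ∃₂)
open import Data.Sum using (_⊎_; inj₁; inj₂; [_,_]; [_,_]′)
open import Data.Vec using (Vec; []; _∷_; lookup; map; replicate; tabulate; zipWith)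
open import Data.Vec.Functional using () renaming (_∷_ to _◂_)
open import Data.Vec.Properties
  using (≡-dec; zipWith-assoc; zipWith-comm; zipWith-identityˡ; zipWith-identityʳ;
         zipWith-replicate₂; map-cong; map-∘; map-id; zipWith-inverseʳ; tabulate-cong; tabulate∘lookup)
open import Function using (_∘_; id; Inverse)
open import Relation.Binary.PropositionalEquality
  using (_≡_; refl; sym; trans; cong; cong₂; subst; subst₂; _≢_; module ≡-Reasoning)
open import Relation.Binary.PropositionalEquality.Algebra using (isMagma)
open import Relation.Nullary using (¬_; Dec; yes; no)
open import Relation.Nullary.Decidable using (_⊎-dec_; map′)

⊕-assoc : ∀ x y z → (x ⊕ y) ⊕ z ≡ x ⊕ (y ⊕ z)
⊕-assoc = zipWith-assoc xor-assoc

⊕-comm : ∀ x y → x ⊕ y ≡ y ⊕ x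
⊕-comm = zipWith-comm xor-comm

⊕-identityˡ : ∀ x → 𝟘 ⊕ x ≡ x
⊕-identityˡ = zipWith-identityˡ xor-identityˡ

⊕-identityʳ : ∀ x → x ⊕ 𝟘 ≡ x
⊕-identityʳ = zipWith-identityʳ xor-identityʳ

⊕-self : ∀ x → x ⊕ x ≡ 𝟘
⊕-self x = trans (cong (x ⊕_) (sym (map-id x))) (zipWith-inverseʳ {⁻¹ = id} xor-same x)

⊕-cancelˡ : ∀ x y → x ⊕ (x ⊕ y) ≡ y
⊕-cancelˡ x y = begin
  x ⊕ (x ⊕ y)  ≡⟨ sym (⊕-assoc x x y) ⟩
  (x ⊕ x) ⊕ y  ≡⟨ cong (_⊕ y) (⊕-self x) ⟩
  𝟘 ⊕ y        ≡⟨ ⊕-identityˡ y ⟩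
  y            ∎
  where open ≡-Reasoning

⊕-cancelʳ : ∀ x y → (x ⊕ y) ⊕ y ≡ x
⊕-cancelʳ x y = begin
  (x ⊕ y) ⊕ y  ≡⟨ ⊕-assoc x y y ⟩
  x ⊕ (y ⊕ y)  ≡⟨ cong (x ⊕_) (⊕-self y) ⟩
  x ⊕ 𝟘        ≡⟨ ⊕-identityʳ x ⟩
  x            ∎
  where open ≡-Reasoning

⊕-commutativeMonoid : CommutativeMonoid 0ℓ 0ℓ
⊕-commutativeMonoid = record
  { _∙_                 = _⊕_
  ; ε                   = 𝟘
  ; isCommutativeMonoid = record
    { isMonoid = record
      { isSemigroup = record { isMagma = isMagma _⊕_ ; assoc = ⊕-assoc }
      ; identity    = ⊕-identityˡ , ⊕-identityʳ
      }
    ; comm     = ⊕-comm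
    }
  }

open import Algebra.Properties.CommutativeSemigroup
  (CommutativeMonoid.commutativeSemigroup ⊕-commutativeMonoid) using (interchange)

∼-sym : ∀ {x y} → x ∼ y → y ∼ x
∼-sym (inj₁ x≡y)          = inj₁ (sym x≡y)
∼-sym {y = y} (inj₂ refl) = inj₂ (sym (⊕-cancelʳ y 𝟙))

∼-⊕ˡ : ∀ z {x y} → x ∼ y → z ⊕ x ∼ z ⊕ y
∼-⊕ˡ z (inj₁ refl)          = inj₁ refl
∼-⊕ˡ z {y = y} (inj₂ refl) = inj₂ (sym (⊕-assoc z y 𝟙))

_∼?_ : ∀ x y → Dec (x ∼ y)
x ∼? y = ≡-dec _≟ᴮ_ x y ⊎-dec ≡-dec _≟ᴮ_ x (y ⊕ 𝟙)

∼⇒⊕∼𝟘 : ∀ {x y} → x ∼ y → x ⊕ y ∼ 𝟘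
∼⇒⊕∼𝟘 {x} {y} x∼y = ∼-sym (subst (_∼ x ⊕ y) (⊕-self x) (∼-⊕ˡ x x∼y))

⊕∼𝟘⇒∼ : ∀ {x y} → x ⊕ y ∼ 𝟘 → x ∼ y
⊕∼𝟘⇒∼ {x} {y} x⊕y∼𝟘 = ∼-sym (subst₂ _∼_ (⊕-cancelˡ x y) (⊕-identityʳ x) (∼-⊕ˡ x x⊕y∼𝟘))

-- The representative of the class with first coordinate false, with that coordinate dropped.
classCode : F₂⁶ → Vec Bool 5
classCode (false ∷ xs) = xs
classCode (true  ∷ xs) = map not xs

xor-ones : ∀ {n} (xs : Vec Bool n) → zipWith _xor_ xs (replicate n true) ≡ map not xs
xor-ones xs = trans (zipWith-replicate₂ _xor_ xs true) (map-cong (λ a → xor-comm a true) xs)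

map-not-involutive : ∀ {n} (xs : Vec Bool n) → map not (map not xs) ≡ xs
map-not-involutive xs =
  trans (sym (map-∘ not not xs)) (trans (map-cong not-involutive xs) (map-id xs))

classCode-≡⇒∼ : ∀ x y → classCode x ≡ classCode y → x ∼ y
classCode-≡⇒∼ (false ∷ xs) (false ∷ ys) e = inj₁ (cong (false ∷_) e)
classCode-≡⇒∼ (true  ∷ xs) (true  ∷ ys) e = inj₁ (cong (true ∷_) (begin
  xs                    ≡⟨ sym (map-not-involutive xs) ⟩
  map not (map not xs)  ≡⟨ cong (map not) e ⟩
  map not (map not ys)  ≡⟨ map-not-involutive ys ⟩
  ys                    ∎))
  where open ≡-Reasoning
classCode-≡⇒∼ (false ∷ xs) (true  ∷ ys) e = inj₂ (cong (false ∷_) (trans e (sym (xor-ones ys))))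
classCode-≡⇒∼ (true  ∷ xs) (false ∷ ys) e = inj₂ (cong (true ∷_) (begin
  xs                    ≡⟨ sym (map-not-involutive xs) ⟩
  map not (map not xs)  ≡⟨ cong (map not) e ⟩
  map not ys            ≡⟨ sym (xor-ones ys) ⟩
  zipWith _xor_ ys (replicate 5 true) ∎))
  where open ≡-Reasoning

toFin : ∀ {n} → Vec Bool n → Fin (2 ^ n)
toFin []       = zero
toFin (a ∷ xs) = combine (Inverse.from 2↔Bool a) (toFin xs)

fromFin : ∀ n → Fin (2 ^ n) → Vec Bool n
fromFin ℕ.zero    _ = []
fromFin (ℕ.suc n) k =
  Inverse.to 2↔Bool (quotient (2 ^ n) k) ∷ fromFin n (remainder {2} (2 ^ n) k)

toFin-fromFin : ∀ n (k : Fin (2 ^ n)) → toFin (fromFin n k) ≡ k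
toFin-fromFin ℕ.zero    zero = refl
toFin-fromFin (ℕ.suc n) k    =
  trans (cong₂ combine (Inverse.strictlyInverseʳ 2↔Bool (quotient (2 ^ n) k))
                       (toFin-fromFin n (remainder {2} (2 ^ n) k)))
        (combine-remQuot {2} (2 ^ n) k)

toFin-injective : ∀ {n} {xs ys : Vec Bool n} → toFin xs ≡ toFin ys → xs ≡ ys
toFin-injective {xs = []}     {[]}     _ = refl
toFin-injective {xs = a ∷ xs} {b ∷ ys} e with combine-injective _ _ _ _ e
... | a≡b , xs≡ys = cong₂ _∷_ (bit-injective a≡b) (toFin-injective xs≡ys)
  where
  bit-injective : Inverse.from 2↔Bool a ≡ Inverse.from 2↔Bool b → a ≡ b
  bit-injective e = trans (sym (Inverse.strictlyInverseˡ 2↔Bool a))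
                   (trans (cong (Inverse.to 2↔Bool) e) (Inverse.strictlyInverseˡ 2↔Bool b))

Vec-Bool-pigeonhole : ∀ {m n} → m < n → (f : Vec Bool n → Vec Bool m) →
                      ∃₂ λ xs ys → xs ≢ ys × f xs ≡ f ys
Vec-Bool-pigeonhole {n = n} m<n f
  with i , j , i<j , fᵢ≡fⱼ ← pigeonhole (^-monoʳ-< 2 (s≤s (s≤s z≤n)) m<n) (toFin ∘ f ∘ fromFin n)
  = fromFin n i , fromFin n j , fromFinᵢ≢fromFinⱼ , toFin-injective fᵢ≡fⱼ
  where
  fromFinᵢ≢fromFinⱼ : fromFin n i ≢ fromFin n j
  fromFinᵢ≢fromFinⱼ e =
    <-irrefl (trans (sym (toFin-fromFin n i)) (trans (cong toFin e) (toFin-fromFin n j))) i<j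

Independent : ∀ {n} → (Fin n → F₂⁶) → Set
Independent b = ∀ c → lincomb c b ∼ 𝟘 → ∀ i → c i ≡ false

InSpan : ∀ {n} → (Fin n → F₂⁶) → F₂⁶ → Set
InSpan {n} b x = Σ (Fin n → Bool) λ c → x ∼ lincomb c b

if-xor : ∀ p q v → (if p xor q then v else 𝟘) ≡ (if p then v else 𝟘) ⊕ (if q then v else 𝟘)
if-xor false false v = refl
if-xor false true  v = sym (⊕-identityˡ v)
if-xor true  false v = sym (⊕-identityʳ v)
if-xor true  true  v = sym (⊕-self v)

lincomb-xor : ∀ {n} (c c′ : Fin n → Bool) (b : Fin n → F₂⁶) →
              lincomb (λ i → c i xor c′ i) b ≡ lincomb c b ⊕ lincomb c′ b
lincomb-xor {ℕ.zero}  c c′ b = refl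
lincomb-xor {ℕ.suc n} c c′ b =
  trans (cong₂ _⊕_ (if-xor (c zero) (c′ zero) (b zero)) (lincomb-xor (c ∘ suc) (c′ ∘ suc) (b ∘ suc)))
        (interchange _ _ _ _)

module _ {n} {b : Fin n → F₂⁶} (z : F₂⁶) {x : F₂⁶} where

  InSpan-◂⁺ˡ : InSpan b x → InSpan (z ◂ b) x
  InSpan-◂⁺ˡ (c , x∼L) = false ◂ c , subst (x ∼_) (sym (⊕-identityˡ _)) x∼L

  InSpan-◂⁺ʳ : InSpan b (z ⊕ x) → InSpan (z ◂ b) x
  InSpan-◂⁺ʳ (c , z⊕x∼L) = true ◂ c , subst (_∼ z ⊕ _) (⊕-cancelˡ z x) (∼-⊕ˡ z z⊕x∼L)

  InSpan-◂⁻ : InSpan (z ◂ b) x → InSpan b x ⊎ InSpan b (z ⊕ x)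
  InSpan-◂⁻ (c , x∼L) with c zero
  ... | false = inj₁ (c ∘ suc , subst (x ∼_) (⊕-identityˡ _) x∼L)
  ... | true  = inj₂ (c ∘ suc , subst (z ⊕ x ∼_) (⊕-cancelˡ z _) (∼-⊕ˡ z x∼L))

-- lincomb only inspects b zero and b ∘ suc, so InSpan b and InSpan (b zero ◂ b ∘ suc) agree definitionally.
InSpan? : ∀ {n} (b : Fin n → F₂⁶) x → Dec (InSpan b x)
InSpan? {ℕ.zero}  b x = map′ (λ x∼𝟘 → (λ ()) , x∼𝟘) proj₂ (x ∼? 𝟘)
InSpan? {ℕ.suc n} b x =
  map′ [ InSpan-◂⁺ˡ (b zero) , InSpan-◂⁺ʳ (b zero) ] (InSpan-◂⁻ (b zero))
       (InSpan? (b ∘ suc) x ⊎-dec InSpan? (b ∘ suc) (b zero ⊕ x))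

Independent-◂ : ∀ {n} {b : Fin n → F₂⁶} {z} → Independent b → ¬ InSpan b z → Independent (z ◂ b)
Independent-◂ ind z∉span c rel with c zero in c₀≡
... | true  = ⊥-elim (z∉span (c ∘ suc , ⊕∼𝟘⇒∼ rel))
... | false = λ { zero → c₀≡ ; (suc i) → ind (c ∘ suc) (subst (_∼ 𝟘) (⊕-identityˡ _) rel) i }

xor≡false⇒≡ : ∀ p q → p xor q ≡ false → p ≡ q
xor≡false⇒≡ false false _ = refl
xor≡false⇒≡ true  true  _ = refl
xor≡false⇒≡ false true  ()
xor≡false⇒≡ true  false ()

six-dependent : (b : Fin 6 → F₂⁶) → ¬ Independent b
six-dependent b ind = collision (Vec-Bool-pigeonhole (n<1+n 5) code)
  where
  code : Vec Bool 6 → Vec Bool 5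
  code u = classCode (lincomb (lookup u) b)

  collision : (∃₂ λ u v → u ≢ v × code u ≡ code v) → ⊥
  collision (u , v , u≢v , same) = u≢v (begin
      u                   ≡⟨ sym (tabulate∘lookup u) ⟩
      tabulate (lookup u) ≡⟨ tabulate-cong (λ i → xor≡false⇒≡ (lookup u i) (lookup v i)
                                                               (ind difference relation i)) ⟩
      tabulate (lookup v) ≡⟨ tabulate∘lookup v ⟩
      v                   ∎)
    where
    open ≡-Reasoning
    difference : Fin 6 → Bool
    difference i = lookup u i xor lookup v i
    relation : lincomb difference b ∼ 𝟘
    relation = subst (_∼ 𝟘) (sym (lincomb-xor (lookup u) (lookup v) b))
                     (∼⇒⊕∼𝟘 (classCode-≡⇒∼ (lincomb (lookup u) b) (lincomb (lookup v) b) same))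

five-independent-span : (b : Fin 5 → F₂⁶) → Independent b → ∀ x → InSpan b x
five-independent-span b ind x with InSpan? b x
... | yes x∈span = x∈span
... | no  x∉span = ⊥-elim (six-dependent (x ◂ b) (Independent-◂ {b = b} ind x∉span))

module _ {U : F₂⁶ → Set} (subspace : IsSubspaceV U) where
  open IsSubspaceV subspace

  lincomb-closed : ∀ {n} {b : Fin n → F₂⁶} → (∀ i → U (b i)) → ∀ c → U (lincomb c b)
  lincomb-closed {ℕ.zero}  _  c = has0
  lincomb-closed {ℕ.suc n} bU c = close (scaled (c zero)) (lincomb-closed (bU ∘ suc) (c ∘ suc))
    where
    scaled : ∀ p → U (if p then _ else 𝟘)
    scaled true  = bU zero
    scaled false = has0

  module _ {n} {b : Fin n → F₂⁶} (basis : IsBasisV U b) where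
    open IsBasisV basis

    InSpan⇒∈ : ∀ {x} → InSpan b x → U x
    InSpan⇒∈ (c , x∼L) = resp (∼-sym x∼L) (lincomb-closed inU c)

    ∈? : ∀ x → Dec (U x)
    ∈? x = map′ InSpan⇒∈ (spanning x) (InSpan? b x)

  x∉U⇒y∉U⇒x⊕y∈U : HasDimV U 4 → ∀ {x y} → ¬ U x → ¬ U y → U (x ⊕ y)
  x∉U⇒y∉U⇒x⊕y∈U (b , basis) {x} {y} x∉U y∉U with ∈? basis (x ⊕ y)
  ... | yes x⊕y∈U = x⊕y∈U
  ... | no  x⊕y∉U =
    ⊥-elim ([ y∉U ∘ InSpan⇒∈ basis , x∉U ∘ subst U (⊕-cancelʳ x y) ∘ InSpan⇒∈ basis ]′
              (InSpan-◂⁻ {b = b} (x ⊕ y) (five-independent-span ((x ⊕ y) ◂ b) extended y)))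
    where
    extended : Independent ((x ⊕ y) ◂ b)
    extended = Independent-◂ {b = b} (IsBasisV.indep basis) (x⊕y∉U ∘ InSpan⇒∈ basis)

mainTheorem4 : (U : F₂⁶ → Set) → IsSubspaceV U → HasDimV U 4
    → (∀ x → U x → ¬ (S x ≡ 1))
    → Σ F₂⁶ λ a → Σ F₂⁶ λ b → Σ F₂⁶ λ c →
    (U a × S a ≡ 2) × (U b × S b ≡ 2) × (U c × S c ≡ 2) × (a ⊕ b ⊕ c ∼ 𝟘)
mainTheorem4 U subspace dim S≢1 =
  e₁ ⊕ e₂ , e₂ ⊕ e₃ , e₁ ⊕ e₃ ,
  (sum∈U e₁ e₂ refl refl , refl) , (sum∈U e₂ e₃ refl refl , refl) ,
  (sum∈U e₁ e₃ refl refl , refl) , inj₁ refl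
  where
  e₁ e₂ e₃ : F₂⁶
  e₁ = true  ∷ false ∷ false ∷ false ∷ false ∷ false ∷ []
  e₂ = false ∷ true  ∷ false ∷ false ∷ false ∷ false ∷ []
  e₃ = false ∷ false ∷ true  ∷ false ∷ false ∷ false ∷ []

  sum∈U : ∀ x y → S x ≡ 1 → S y ≡ 1 → U (x ⊕ y)
  sum∈U x y Sx≡1 Sy≡1 =
    x∉U⇒y∉U⇒x⊕y∈U subspace dim (λ x∈U → S≢1 x x∈U Sx≡1) (λ y∈U → S≢1 y y∈U Sy≡1)
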